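{- Let $G$ be a finite abelian group of odd order and $S$ a sequence over $G$ with $|S|\ge D(G)-1$ such that $0$ is not a term of $S$ and $E(S) = \{0\}$. Then, with $r = |S|-D(G)+1$, $S$ contains exactly $r$ minimal zero-sum subsequences $T_1, \ldots, T_r$, they are pairwise disjoint, and $S = T_1 T_2 \cdots T_r$.
   Context: A sequence over $G$ is a finite unordered list $S = g_1 \cdots g_m$ of elements of $G$ with repetition allowed (element of the free abelian monoid on $G$, product = concatenation); $|S| = m$; subsequences are sub-multisets. For $g\in G$, $N_g(S) = |\{I \subseteq [1,m] : \sum_{i\in I} g_i = g\}|$ (empty index set included). $D(G)$ is the smallest positive integer $\ell$ such that every sequence over $G$ of length at least $\ell$ has a nonempty subsequence with sum $0$. $E(S) = \{g\in G : N_g(S) = 2^{|S|-D(G)+1}\}$. A minimal zero-sum sequence is a nonempty sequence with sum $0$ none of whose nonempty proper subsequences has sum $0$. Two subsequences are disjoint if their greatest common divisor is the empty sequence. -}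

module Defs where

open import Level using (Level)
open import Algebra.Bundles using (AbelianGroup)
open import Data.Nat using (ℕ; zero; suc; _≤_; _∸_; _+_; _^_)
open import Data.Fin using (Fin)
import Data.Fin.Properties as FinP
open import Data.Fin.Subset using (Subset; _∈_; _⊂_; Nonempty; inside; outside)
open import Data.Vec using (Vec; []; _∷_; lookup)
open import Data.List using (List; []; _∷_; map; _++_; length; filter)
open import Data.Product using (Σ; ∃; _×_; _,_)
open import Function.Bundles using (Inverse)
open import Relation.Nullary using (¬_; yes; no)
open import Relation.Binary using (Decidable)
import Relation.Binary.PropositionalEquality as ≡
open ≡ using (_≡_; _≢_)

allSubsets : (m : ℕ) → List (Subset m)
allSubsets zero = [] ∷ []
allSubsets (suc m) = map (inside ∷_) (allSubsets m) ++ map (outside ∷_) (allSubsets m)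

module _ {c ℓ : Level} (G : AbelianGroup c ℓ) where
  open AbelianGroup G

  -- A finite abelian group of order n: an explicit bijection between
  -- Fin n and the elements of G (up to the group's equality).
  FiniteOfOrder : ℕ → Set _
  FiniteOfOrder n = Inverse (≡.setoid (Fin n)) setoid

  σ : {m : ℕ} → Vec Carrier m → Subset m → Carrier
  σ [] [] = ε
  σ (x ∷ S) (inside ∷ I) = x ∙ σ S I
  σ (x ∷ S) (outside ∷ I) = σ S I

  HasNonemptyZeroSum : {m : ℕ} → Vec Carrier m → Set _
  HasNonemptyZeroSum {m} S = Σ (Subset m) λ I → Nonempty I × (σ S I ≈ ε)

  DavenportBound : ℕ → Set _
  DavenportBound k = (m : ℕ) → k ≤ m → (S : Vec Carrier m) → HasNonemptyZeroSum S

  IsDavenportConstant : ℕ → Set _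
  IsDavenportConstant d =
    (1 ≤ d) × DavenportBound d × ((k : ℕ) → 1 ≤ k → DavenportBound k → d ≤ k)

  IsMinimalZeroSum : {m : ℕ} → Vec Carrier m → Subset m → Set _
  IsMinimalZeroSum S I =
    Nonempty I × (σ S I ≈ ε) × (∀ J → J ⊂ I → Nonempty J → ¬ (σ S J ≈ ε))

  module _ {n : ℕ} (fin : FiniteOfOrder n) where
    open Inverse fin using (to; from; from-cong; strictlyInverseˡ)

    _≈?_ : Decidable _≈_
    x ≈? y with from x FinP.≟ from y
    ... | yes p = yes (trans (sym (strictlyInverseˡ x))
                        (trans (reflexive (≡.cong to p)) (strictlyInverseˡ y)))
      where open import Relation.Binary.PropositionalEquality using (cong)
    ... | no ¬p = no λ x≈y → ¬p (from-cong x≈y)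

    -- N_g(S) = |{ I ⊆ [1,m] : σ(S_I) = g }|  (empty set included)
    N : {m : ℕ} → Carrier → Vec Carrier m → ℕ
    N {m} g S = length (filter (λ I → σ S I ≈? g) (allSubsets m))

    InE : {m : ℕ} → ℕ → Vec Carrier m → Carrier → Set
    InE {m} d S g = N g S ≡ 2 ^ (m + 1 ∸ d)

-- Write N(U, g) for the number of subsets of U ⊆ [1, m] whose terms sum to g. If J ⊆ U sums to g,
-- then I ↦ I Δ J matches these subsets with the zero-sum subsets of U for S with the terms of J
-- negated; and for x in a zero-sum subset of U, splitting according to x gives
--   N(U, 0) = N(U - x, -S_x) + N(U - x, 0).
-- With the Davenport property this yields N(U, g) ≥ 2 ^ (|U| + 1 - D) for every attained g.
-- E(S) = {0} says that N([1, m], 0) attains this bound; by complementation so does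
-- N([1, m], σ(S)), whence σ(S) = 0 and every term lies in a zero-sum subset. When N(U, 0) attains
-- the bound, both halves of the splitting equal 2 ^ (|U| - D) and N(U - x, 0) attains it again.
-- By induction on |U|, no two distinct minimal zero-sum subsets A, B share a point y: equal halves
-- at a point of A ∖ B and at y yield a minimal zero-sum subset R through A ∖ B avoiding y, and
-- either R, A, B share a point, through which then too many zero-sum subsets pass, or
-- R = (A ∖ B) ∪ (B ∖ A), so that σ(A ∖ B) = σ(B ∖ A) = -σ(A ∩ B) has order at most 2, which odd
-- order excludes. So the minimal zero-sum subsets are disjoint blocks covering [1, m], the
-- zero-sum subsets are the unions of blocks, and N([1, m], 0) = 2 ^ r counts the blocks. Terms of
-- different blocks differ: exchanging two equal ones would make a block the singleton of a zero.

module Submission where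

open import Algebra.Bundles using (AbelianGroup)
open import Data.Fin using (Fin)
open import Data.Fin.Subset using (Subset; _∈_) renaming (⊤ to full)
open import Data.Fin.Subset.Properties using (∈⊤; ⊆-max; ∣⊤∣≡n)
open import Data.Nat using (ℕ; _≤_; _+_; _∸_; _^_; suc)
open import Data.Nat.Divisibility using (_∣_)
open import Data.Nat.Properties using (+-comm)
open import Data.Product using (Σ; ∃; _×_; _,_; proj₁; proj₂)
open import Data.Vec using (Vec; lookup)
open import Relation.Nullary using (¬_)
open import Relation.Binary.PropositionalEquality using (_≡_; _≢_)
import Relation.Binary.PropositionalEquality as ≡
open import Defs using (FiniteOfOrder; IsDavenportConstant; IsMinimalZeroSum; InE)

module Subsets where

  open import Data.Empty using (⊥-elim)
  open import Data.Fin using (zero; suc)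
  open import Data.Fin.Properties using (any?)
  open import Data.Fin.Subset using (inside; outside; _∉_; _⊆_; _⊂_; _∩_; _─_; _∪_; _-_; ⁅_⁆; ∣_∣)
  open import Data.Fin.Subset.Properties
    using (_∈?_; _⊆?_; ⊆-antisym; p─q⊆p; p─⊥≡p; p∩q⊆q; x∈p∩q⁺; x∈p∪q⁻; x∈p∪q⁺; x∈p∧x∉q⇒x∈p─q;
           x∈p∧x≢y⇒x∈p-y; x∉⁅y⁆⇒x≢y; x∈⁅y⁆⇒x≡y)
  open import Data.Sum using (_⊎_; inj₁; inj₂)
  open import Data.Vec using (_∷_; here; there)
  open import Relation.Nullary using (yes; no; ¬?; contradiction)
  open import Relation.Nullary.Decidable using (_×-dec_)
  open import Relation.Binary.PropositionalEquality using (refl; sym; cong)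

  private
    variable
      m : ℕ
      x y : Fin m
      p q : Subset m

  infixl 5 _Δ_
  _Δ_ : Subset m → Subset m → Subset m
  p Δ q = (p ─ q) ∪ (q ─ p)

  Disjoint : Subset m → Subset m → Set
  Disjoint p q = ∀ {x} → x ∈ p → x ∉ q

  x∈p─q⇒x∉q : x ∈ p ─ q → x ∉ q
  x∈p─q⇒x∉q {p = _ ∷ p} {q = outside ∷ q} (there x∈) (there x∈q) = x∈p─q⇒x∉q x∈ x∈q
  x∈p─q⇒x∉q {p = _ ∷ p} {q = inside ∷ q}  (there x∈) (there x∈q) = x∈p─q⇒x∉q x∈ x∈q

  x∈pΔq⁻ : ∀ (p q : Subset m) → x ∈ p Δ q → x ∈ p × x ∉ q ⊎ x ∈ q × x ∉ p
  x∈pΔq⁻ p q x∈ with x∈p∪q⁻ (p ─ q) (q ─ p) x∈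
  ... | inj₁ x∈p─q = inj₁ (p─q⊆p p q x∈p─q , x∈p─q⇒x∉q x∈p─q)
  ... | inj₂ x∈q─p = inj₂ (p─q⊆p q p x∈q─p , x∈p─q⇒x∉q x∈q─p)

  x∈pΔq⁺ : x ∈ p × x ∉ q ⊎ x ∈ q × x ∉ p → x ∈ p Δ q
  x∈pΔq⁺ (inj₁ (x∈p , x∉q)) = x∈p∪q⁺ (inj₁ (x∈p∧x∉q⇒x∈p─q x∈p x∉q))
  x∈pΔq⁺ (inj₂ (x∈q , x∉p)) = x∈p∪q⁺ (inj₂ (x∈p∧x∉q⇒x∈p─q x∈q x∉p))

  x∈p-y⁻ : x ∈ p - y → x ∈ p × x ≢ y
  x∈p-y⁻ {p = p} {y = y} x∈ = p─q⊆p p ⁅ y ⁆ x∈ , x∉⁅y⁆⇒x≢y (x∈p─q⇒x∉q x∈)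

  ∣p∣≡1+∣p-x∣ : x ∈ p → ∣ p ∣ ≡ suc ∣ p - x ∣
  ∣p∣≡1+∣p-x∣ {x = zero}  {p = inside ∷ p} here = cong suc (cong ∣_∣ (sym (p─⊥≡p p)))
  ∣p∣≡1+∣p-x∣ {x = suc x} {p = inside ∷ p}  (there x∈p) = cong suc (∣p∣≡1+∣p-x∣ x∈p)
  ∣p∣≡1+∣p-x∣ {x = suc x} {p = outside ∷ p} (there x∈p) = ∣p∣≡1+∣p-x∣ x∈p

  ⊈⇒∃∉ : ¬ p ⊆ q → ∃ λ x → x ∈ p × x ∉ q
  ⊈⇒∃∉ {p = p} {q = q} p⊈q with any? (λ x → x ∈? p ×-dec ¬? (x ∈? q))
  ... | yes witness = witness
  ... | no ∄witness = ⊥-elim (p⊈q p⊆q)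
    where
    p⊆q : p ⊆ q
    p⊆q {x} x∈p with x ∈? q
    ... | yes x∈q = x∈q
    ... | no x∉q = contradiction (x , x∈p , x∉q) ∄witness

  ⊆∧≢⇒⊂ : p ⊆ q → p ≢ q → p ⊂ q
  ⊆∧≢⇒⊂ {p = p} {q = q} p⊆q p≢q with q ⊆? p
  ... | yes q⊆p = contradiction (⊆-antisym p⊆q q⊆p) p≢q
  ... | no q⊈p = p⊆q , ⊈⇒∃∉ q⊈p

  ⊆-remove : p ⊆ q → x ∉ p → p ⊆ q - x
  ⊆-remove p⊆q x∉p y∈p = x∈p∧x≢y⇒x∈p-y (p⊆q y∈p) λ { refl → x∉p y∈p }

  q⊆p⇒p∩q≡q : q ⊆ p → p ∩ q ≡ q
  q⊆p⇒p∩q≡q {q = q} {p = p} q⊆p = ⊆-antisym (p∩q⊆q p q) (λ x∈q → x∈p∩q⁺ (q⊆p x∈q , x∈q))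

  ⁅x⁆⊆p : x ∈ p → ⁅ x ⁆ ⊆ p
  ⁅x⁆⊆p {x = x} {p = p} x∈p y∈⁅x⁆ rewrite x∈⁅y⁆⇒x≡y x y∈⁅x⁆ = x∈p

  ⊆-Δ : ∀ {r} → p ⊆ r → q ⊆ r → p Δ q ⊆ r
  ⊆-Δ {p = p} {q = q} p⊆r q⊆r x∈pΔq with x∈pΔq⁻ p q x∈pΔq
  ... | inj₁ (x∈p , _) = p⊆r x∈p
  ... | inj₂ (x∈q , _) = q⊆r x∈q

  ⊆-Δ⁻ : ∀ {r} → p Δ q ⊆ r → q ⊆ r → p ⊆ r
  ⊆-Δ⁻ {q = q} pΔq⊆r q⊆r {x} x∈p with x ∈? q
  ... | yes x∈q = q⊆r x∈q
  ... | no x∉q = pΔq⊆r (x∈pΔq⁺ (inj₁ (x∈p , x∉q)))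

  p⊆q⇒p-x⊆q-x : p ⊆ q → p - x ⊆ q - x
  p⊆q⇒p-x⊆q-x p⊆q y∈p-x = let y∈p , y≢x = x∈p-y⁻ y∈p-x in x∈p∧x≢y⇒x∈p-y (p⊆q y∈p) y≢x

module Counting where

  open import Data.Bool using (true; false)
  import Data.Bool.Properties as Bool
  open import Data.Empty using (⊥-elim)
  open import Data.Fin.Subset using (inside; outside)
  open import Data.List using (List; []; _∷_; map; _++_; length; filter)
  open import Data.List.Properties using (length-++; filter-++)
  open import Data.Nat using (zero; _<_; z≤n; s≤s)
  open import Data.Nat.Properties using (≤-trans; m≤m+n; m≤n+m; +-cancelˡ-≡; +-commutativeSemigroup)
  open import Data.Product using (swap)
  open import Data.Vec using ([]; _∷_)
  open import Data.Vec.Properties using (∷-injectiveʳ; ≡-dec)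
  open import Function using (_∘_)
  open import Level using (Level)
  open import Relation.Nullary using (Dec; yes; no; does)
  open import Relation.Unary using (Pred; Decidable)
  open import Relation.Unary.Properties using (_∩?_; ∁?)
  open import Relation.Binary.PropositionalEquality
    using (refl; sym; trans; cong; cong₂; subst; module ≡-Reasoning)
  open import Algebra.Properties.CommutativeSemigroup +-commutativeSemigroup using (interchange)
  open import Defs using (allSubsets)
  open Subsets using (_Δ_)

  private
    variable
      p q : Level

  indicator : ∀ {a} {A : Set a} → Dec A → ℕ
  indicator (yes _) = 1
  indicator (no _) = 0

  count : ∀ {m} {P : Pred (Subset m) p} → Decidable P → ℕ
  count {m = zero} P? = indicator (P? [])
  count {m = suc m} P? = count (P? ∘ (inside ∷_)) + count (P? ∘ (outside ∷_))

  count-cong : ∀ {m} {P : Pred (Subset m) p} {Q : Pred (Subset m) q} (P? : Decidable P) (Q? : Decidable Q) →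
    (∀ I → P I → Q I) → (∀ I → Q I → P I) → count P? ≡ count Q?
  count-cong {m = zero} P? Q? P⇒Q Q⇒P with P? [] | Q? []
  ... | yes _ | yes _ = refl
  ... | no _  | no _  = refl
  ... | yes P[] | no ¬Q[] = ⊥-elim (¬Q[] (P⇒Q [] P[]))
  ... | no ¬P[] | yes Q[] = ⊥-elim (¬P[] (Q⇒P [] Q[]))
  count-cong {m = suc m} P? Q? P⇒Q Q⇒P = cong₂ _+_
    (count-cong _ _ (P⇒Q ∘ (inside ∷_)) (Q⇒P ∘ (inside ∷_)))
    (count-cong _ _ (P⇒Q ∘ (outside ∷_)) (Q⇒P ∘ (outside ∷_)))

  count-split : ∀ {m} {P : Pred (Subset m) p} {Q : Pred (Subset m) q} (P? : Decidable P) (Q? : Decidable Q) →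
    count P? ≡ count (P? ∩? Q?) + count (P? ∩? ∁? Q?)
  count-split {m = zero} P? Q? with P? [] | Q? []
  ... | yes _ | yes _ = refl
  ... | yes _ | no _  = refl
  ... | no _  | _     = refl
  count-split {m = suc m} P? Q? = trans
    (cong₂ _+_ (count-split _ (Q? ∘ (inside ∷_))) (count-split _ (Q? ∘ (outside ∷_))))
    (interchange (count ((P? ∩? Q?) ∘ (inside ∷_))) (count ((P? ∩? ∁? Q?) ∘ (inside ∷_)))
                 (count ((P? ∩? Q?) ∘ (outside ∷_))) (count ((P? ∩? ∁? Q?) ∘ (outside ∷_))))

  count-pos : ∀ {m} {P : Pred (Subset m) p} (P? : Decidable P) {I} → P I → 0 < count P?
  count-pos {m = zero} P? {[]} PI with P? []
  ... | yes _ = s≤s z≤n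
  ... | no ¬PI = ⊥-elim (¬PI PI)
  count-pos {m = suc m} P? {inside ∷ I} PI = ≤-trans (count-pos (P? ∘ (inside ∷_)) PI) (m≤m+n _ _)
  count-pos {m = suc m} P? {outside ∷ I} PI = ≤-trans (count-pos (P? ∘ (outside ∷_)) PI) (m≤n+m _ _)

  count-witness : ∀ {m} {P : Pred (Subset m) p} (P? : Decidable P) → 0 < count P? → ∃ P
  count-witness {m = zero} P? pos with P? []
  ... | yes P[] = [] , P[]
  count-witness {m = suc m} P? pos
    with count (P? ∘ (inside ∷_)) | count-witness (P? ∘ (inside ∷_))
  ... | zero  | _       = let I , PI = count-witness _ pos in outside ∷ I , PI
  ... | suc _ | witness = let I , PI = witness (s≤s z≤n) in inside ∷ I , PI

  count-none : ∀ {m} {P : Pred (Subset m) p} (P? : Decidable P) → (∀ I → ¬ P I) → count P? ≡ 0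
  count-none {m = zero} P? ¬P with P? []
  ... | yes P[] = ⊥-elim (¬P [] P[])
  ... | no _ = refl
  count-none {m = suc m} P? ¬P =
    cong₂ _+_ (count-none _ (¬P ∘ (inside ∷_))) (count-none _ (¬P ∘ (outside ∷_)))

  count-unique : ∀ {m} {P : Pred (Subset m) p} (P? : Decidable P) {J} → P J → (∀ I → P I → I ≡ J) →
    count P? ≡ 1
  count-unique {m = zero} P? {[]} PJ _ with P? []
  ... | yes _ = refl
  ... | no ¬PJ = ⊥-elim (¬PJ PJ)
  count-unique {m = suc m} P? {inside ∷ J} PJ unique = cong₂ _+_
    (count-unique (P? ∘ (inside ∷_)) PJ (λ I PI → ∷-injectiveʳ (unique _ PI)))
    (count-none (P? ∘ (outside ∷_)) (λ I PI → case-inside (unique _ PI)))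
    where case-inside : ∀ {I} → outside ∷ I ≢ inside ∷ J
          case-inside ()
  count-unique {m = suc m} P? {outside ∷ J} PJ unique = cong₂ _+_
    (count-none (P? ∘ (inside ∷_)) (λ I PI → case-outside (unique _ PI)))
    (count-unique (P? ∘ (outside ∷_)) PJ (λ I PI → ∷-injectiveʳ (unique _ PI)))
    where case-outside : ∀ {I} → inside ∷ I ≢ outside ∷ J
          case-outside ()

  _≟_ : ∀ {m} (I J : Subset m) → Dec (I ≡ J)
  _≟_ = ≡-dec Bool._≟_

  count-remove : ∀ {m} {P : Pred (Subset m) p} (P? : Decidable P) {J} → P J →
    count P? ≡ suc (count (P? ∩? ∁? (_≟ J)))
  count-remove P? {J} PJ = trans (count-split P? (_≟ J))
    (cong (_+ count (P? ∩? ∁? (_≟ J))) (count-unique (P? ∩? (_≟ J)) (PJ , refl) (λ _ → proj₂)))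

  count-Δ : ∀ {m} {P : Pred (Subset m) p} (P? : Decidable P) (J : Subset m) →
    count P? ≡ count (λ I → P? (I Δ J))
  count-Δ {m = zero} P? [] = refl
  count-Δ {m = suc m} P? (inside ∷ J) = trans (+-comm (count (P? ∘ (inside ∷_))) _)
    (cong₂ _+_ (count-Δ (P? ∘ (outside ∷_)) J) (count-Δ (P? ∘ (inside ∷_)) J))
  count-Δ {m = suc m} P? (outside ∷ J) =
    cong₂ _+_ (count-Δ (P? ∘ (inside ∷_)) J) (count-Δ (P? ∘ (outside ∷_)) J)

  count-exchange : ∀ {m} {P : Pred (Subset m) p} {Q : Pred (Subset m) q}
    (P? : Decidable P) (Q? : Decidable Q) →
    count P? ≡ count Q? → ∀ {I} → P I → ¬ Q I → ∃ λ J → Q J × ¬ P J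
  count-exchange P? Q? #P≡#Q {I} PI ¬QI = count-witness (Q? ∩? ∁? P?) (subst (0 <_) #P∖Q≡#Q∖P #P∖Q>0)
    where
    #P∖Q>0 : 0 < count (P? ∩? ∁? Q?)
    #P∖Q>0 = count-pos (P? ∩? ∁? Q?) (PI , ¬QI)
    #P∖Q≡#Q∖P : count (P? ∩? ∁? Q?) ≡ count (Q? ∩? ∁? P?)
    #P∖Q≡#Q∖P = +-cancelˡ-≡ (count (P? ∩? Q?)) _ _ (begin
      count (P? ∩? Q?) + count (P? ∩? ∁? Q?) ≡⟨ sym (count-split P? Q?) ⟩
      count P?                               ≡⟨ #P≡#Q ⟩
      count Q?                               ≡⟨ count-split Q? P? ⟩
      count (Q? ∩? P?) + count (Q? ∩? ∁? P?) ≡⟨ cong (_+ count (Q? ∩? ∁? P?)) #Q∩P≡#P∩Q ⟩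
      count (P? ∩? Q?) + count (Q? ∩? ∁? P?) ∎)
      where
      open ≡-Reasoning
      #Q∩P≡#P∩Q : count (Q? ∩? P?) ≡ count (P? ∩? Q?)
      #Q∩P≡#P∩Q = count-cong (Q? ∩? P?) (P? ∩? Q?) (λ _ → swap) (λ _ → swap)

  length-filter-map : ∀ {a b} {A : Set a} {B : Set b} {P : Pred B p}
    (P? : Decidable P) (f : A → B) (xs : List A) →
    length (filter P? (map f xs)) ≡ length (filter (P? ∘ f) xs)
  length-filter-map P? f [] = refl
  length-filter-map P? f (x ∷ xs) with does (P? (f x))
  ... | true = cong suc (length-filter-map P? f xs)
  ... | false = length-filter-map P? f xs

  length-filter-allSubsets : ∀ {m} {P : Pred (Subset m) p} (P? : Decidable P) →
    length (filter P? (allSubsets m)) ≡ count P?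
  length-filter-allSubsets {m = zero} P? with P? []
  ... | yes _ = refl
  ... | no _ = refl
  length-filter-allSubsets {m = suc m} P? = begin
    length (filter P? (ins ++ outs))                 ≡⟨ cong length (filter-++ P? ins outs) ⟩
    length (filter P? ins ++ filter P? outs)         ≡⟨ length-++ (filter P? ins) ⟩
    length (filter P? ins) + length (filter P? outs) ≡⟨ cong₂ _+_
      (trans (length-filter-map P? _ all) (length-filter-allSubsets (P? ∘ (inside ∷_))))
      (trans (length-filter-map P? _ all) (length-filter-allSubsets (P? ∘ (outside ∷_)))) ⟩
    count P?                                         ∎
    where
    open ≡-Reasoning
    all : List (Subset m)
    all = allSubsets m
    ins outs : List (Subset (suc m))
    ins = map (inside ∷_) all
    outs = map (outside ∷_) all

module Parity where

  open import Data.Empty using (⊥-elim)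
  open import Data.Fin using (_<_)
  open import Data.Fin.Properties using (<-cmp; <-asym; _<?_)
  open import Data.Fin.Permutation using (permutation)
  open import Data.Nat using (zero; _*_)
  open import Data.Nat.Divisibility using (divides)
  open import Data.Nat.Properties using (+-identityʳ; *-comm; +-0-commutativeMonoid)
  open import Algebra.Properties.CommutativeMonoid.Sum +-0-commutativeMonoid
    using (sum; sum-permute; ∑-distrib-+; sum-cong-≗)
  open import Function using (_∘_)
  open import Relation.Binary using (tri<; tri≈; tri>)
  open import Relation.Nullary using (yes; no)
  open import Relation.Binary.PropositionalEquality using (refl; sym; cong; subst; module ≡-Reasoning)
  open Counting using (indicator)

  sum-const-1 : ∀ n → sum {n} (λ _ → 1) ≡ n
  sum-const-1 zero = refl
  sum-const-1 (suc n) = cong suc (sum-const-1 n)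

  fixpointFree-involution⇒even : ∀ {n} (f : Fin n → Fin n) →
    (∀ i → f (f i) ≡ i) → (∀ i → f i ≢ i) → 2 ∣ n
  fixpointFree-involution⇒even {n} f involutive fixpointFree = divides (sum lower) (begin
    n                                 ≡⟨ sym (sum-const-1 n) ⟩
    sum {n} (λ _ → 1)                 ≡⟨ sum-cong-≗ {n} pair-sum ⟨
    sum (λ i → lower i + lower (f i)) ≡⟨ ∑-distrib-+ lower (lower ∘ f) ⟩
    sum lower + sum (lower ∘ f)       ≡⟨ cong (sum lower +_) (sum-permute lower (permutation f f involutive involutive)) ⟨
    sum lower + sum lower             ≡⟨ cong (sum lower +_) (+-identityʳ (sum lower)) ⟨
    2 * sum lower                     ≡⟨ *-comm 2 (sum lower) ⟩
    sum lower * 2                     ∎)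
    where
    open ≡-Reasoning
    -- Exactly one of i and f i is the smaller element of the orbit {i , f i}.
    lower : Fin n → ℕ
    lower i = indicator (i <? f i)
    pair-sum : ∀ i → lower i + lower (f i) ≡ 1
    pair-sum i with <-cmp i (f i) | i <? f i | f i <? f (f i)
    ... | tri≈ _ i≡fi _ | _ | _ = ⊥-elim (fixpointFree i (sym i≡fi))
    ... | tri< _ _ _ | yes _ | no _ = refl
    ... | tri> _ _ _ | no _ | yes _ = refl
    ... | tri< i<fi _ _ | no i≮fi | _ = ⊥-elim (i≮fi i<fi)
    ... | tri< i<fi _ _ | yes _ | yes fi<ffi = ⊥-elim (<-asym i<fi (subst (f i <_) (involutive i) fi<ffi))
    ... | tri> _ _ fi<i | yes i<fi | _ = ⊥-elim (<-asym i<fi fi<i)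
    ... | tri> _ _ fi<i | no _ | no fi≮ffi = ⊥-elim (fi≮ffi (subst (f i <_) (sym (involutive i)) fi<i))

module Arithmetic where

  open import Data.Empty using (⊥-elim)
  open import Data.Nat using (_≤?_; z≤n; s≤s)
  open import Data.Nat.Properties
    using (+-monoˡ-≤; +-monoʳ-≤; +-cancelˡ-≤; +-cancelʳ-≤; +-identityʳ; +-∸-assoc; ≤-antisym; ≤-trans; ≤-reflexive;
           m≤n⇒m∸n≡0; ≰⇒>; m^n>0; m≤m+n; <-cmp; <-irrefl; ^-monoʳ-<)
  open import Relation.Binary using (tri<; tri≈; tri>)
  open import Relation.Nullary using (yes; no)

  2^[1+k∸d]≤2^[k∸d]+2^[k∸d] : ∀ k d → 2 ^ (suc k ∸ d) ≤ 2 ^ (k ∸ d) + 2 ^ (k ∸ d)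
  2^[1+k∸d]≤2^[k∸d]+2^[k∸d] k d with d ≤? k
  ... | yes d≤k =
    ≤-reflexive (≡.trans (≡.cong (2 ^_) (+-∸-assoc 1 d≤k)) (≡.cong (2 ^ (k ∸ d) +_) (+-identityʳ _)))
  ... | no d≰k = ≤-trans (≤-reflexive (≡.cong (2 ^_) (m≤n⇒m∸n≡0 (≰⇒> d≰k))))
                         (≤-trans (m^n>0 2 (k ∸ d)) (m≤m+n _ _))

  2^-injective : ∀ {a b} → 2 ^ a ≡ 2 ^ b → a ≡ b
  2^-injective {a} {b} 2^a≡2^b with <-cmp a b
  ... | tri< a<b _ _ = ⊥-elim (<-irrefl 2^a≡2^b (^-monoʳ-< 2 (s≤s (s≤s z≤n)) a<b))
  ... | tri≈ _ a≡b _ = a≡b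
  ... | tri> _ _ a>b = ⊥-elim (<-irrefl (≡.sym 2^a≡2^b) (^-monoʳ-< 2 (s≤s (s≤s z≤n)) a>b))

  +-squeeze : ∀ {t a b} → t ≤ a → t ≤ b → a + b ≤ t + t → a ≡ t × b ≡ t
  +-squeeze {t} {a} {b} t≤a t≤b a+b≤t+t =
    ≤-antisym (+-cancelʳ-≤ b a t (≤-trans a+b≤t+t (+-monoʳ-≤ t t≤b))) t≤a ,
    ≤-antisym (+-cancelˡ-≤ a b t (≤-trans a+b≤t+t (+-monoˡ-≤ t t≤a))) t≤b

module SubsetSums {c ℓ} (G : AbelianGroup c ℓ) where

  open import Data.Bool using (if_then_else_)
  open import Data.Fin using (zero; suc)
  open import Data.Fin.Subset using (inside; outside; _⊆_; _∩_; _─_; _-_; ⁅_⁆; ∣_∣; Nonempty) renaming (⊥ to ∅)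
  open import Data.Fin.Subset.Properties using (p─⊥≡p)
  open import Data.Vec using ([]; _∷_; zipWith; here; there)
  import Defs
  open Subsets using (_Δ_; Disjoint; q⊆p⇒p∩q≡q)

  open AbelianGroup G hiding (_-_)
  open import Algebra.Properties.CommutativeSemigroup commutativeSemigroup using (x∙yz≈y∙xz; interchange)
  open import Relation.Binary.Reasoning.Setoid setoid

  private
    variable
      m : ℕ

  σ : Vec Carrier m → Subset m → Carrier
  σ = Defs.σ G

  σ-∅ : ∀ (S : Vec Carrier m) → σ S ∅ ≈ ε
  σ-∅ [] = refl
  σ-∅ (s ∷ S) = σ-∅ S

  σ-split : ∀ (S : Vec Carrier m) I J → σ S I ≈ σ S (I ∩ J) ∙ σ S (I ─ J)
  σ-split [] [] [] = sym (identityˡ ε)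
  σ-split (s ∷ S) (inside  ∷ I) (inside  ∷ J) = trans (∙-congˡ (σ-split S I J)) (sym (assoc _ _ _))
  σ-split (s ∷ S) (inside  ∷ I) (outside ∷ J) = trans (∙-congˡ (σ-split S I J)) (x∙yz≈y∙xz _ _ _)
  σ-split (s ∷ S) (outside ∷ I) (inside  ∷ J) = σ-split S I J
  σ-split (s ∷ S) (outside ∷ I) (outside ∷ J) = σ-split S I J

  σ-split-⊆ : ∀ (S : Vec Carrier m) {I J} → J ⊆ I → σ S I ≈ σ S J ∙ σ S (I ─ J)
  σ-split-⊆ S {I} {J} J⊆I =
    trans (σ-split S I J) (∙-congʳ (reflexive (≡.cong (σ S) (q⊆p⇒p∩q≡q J⊆I))))

  σ-remove : ∀ (S : Vec Carrier m) {I x} → x ∈ I → σ S I ≈ lookup S x ∙ σ S (I - x)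
  σ-remove (s ∷ S) {inside ∷ I} here = ∙-congˡ (reflexive (≡.cong (σ S) (≡.sym (p─⊥≡p I))))
  σ-remove (s ∷ S) {inside  ∷ I} (there x∈I) = trans (∙-congˡ (σ-remove S x∈I)) (x∙yz≈y∙xz _ _ _)
  σ-remove (s ∷ S) {outside ∷ I} (there x∈I) = σ-remove S x∈I

  σ-⁅⁆ : ∀ (S : Vec Carrier m) x → σ S ⁅ x ⁆ ≈ lookup S x
  σ-⁅⁆ (s ∷ S) zero = trans (∙-congˡ (σ-∅ S)) (identityʳ s)
  σ-⁅⁆ (s ∷ S) (suc x) = σ-⁅⁆ S x

  σ-Δ-disjoint : ∀ (S : Vec Carrier m) {I J} → Disjoint I J → σ S (I Δ J) ≈ σ S I ∙ σ S J
  σ-Δ-disjoint [] {[]} {[]} _ = sym (identityˡ ε)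
  σ-Δ-disjoint (s ∷ S) {inside ∷ I} {inside ∷ J} I∩J=∅ with I∩J=∅ here here
  ... | ()
  σ-Δ-disjoint (s ∷ S) {inside ∷ I} {outside ∷ J} I∩J=∅ =
    trans (∙-congˡ (σ-Δ-disjoint S (λ x∈I x∈J → I∩J=∅ (there x∈I) (there x∈J)))) (sym (assoc _ _ _))
  σ-Δ-disjoint (s ∷ S) {outside ∷ I} {inside ∷ J} I∩J=∅ =
    trans (∙-congˡ (σ-Δ-disjoint S (λ x∈I x∈J → I∩J=∅ (there x∈I) (there x∈J)))) (x∙yz≈y∙xz _ _ _)
  σ-Δ-disjoint (s ∷ S) {outside ∷ I} {outside ∷ J} I∩J=∅ =
    σ-Δ-disjoint S (λ x∈I x∈J → I∩J=∅ (there x∈I) (there x∈J))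

  σ-Δ-full : ∀ (S : Vec Carrier m) I → σ S I ∙ σ S (I Δ full) ≈ σ S full
  σ-Δ-full [] [] = identityˡ ε
  σ-Δ-full (s ∷ S) (inside  ∷ I) = trans (assoc _ _ _) (∙-congˡ (σ-Δ-full S I))
  σ-Δ-full (s ∷ S) (outside ∷ I) = trans (sym (x∙yz≈y∙xz _ _ _)) (∙-congˡ (σ-Δ-full S I))

  negateOn : Vec Carrier m → Subset m → Vec Carrier m
  negateOn = zipWith (λ s b → if b then s ⁻¹ else s)

  σ-Δ-negateOn : ∀ (S : Vec Carrier m) I J → σ S (I Δ J) ≈ σ (negateOn S J) I ∙ σ S J
  σ-Δ-negateOn [] [] [] = sym (identityˡ ε)
  σ-Δ-negateOn (s ∷ S) (inside ∷ I) (inside ∷ J) = begin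
    σ S (I Δ J)          ≈⟨ σ-Δ-negateOn S I J ⟩
    a ∙ b                ≈⟨ identityˡ (a ∙ b) ⟨
    ε ∙ (a ∙ b)          ≈⟨ ∙-congʳ (inverseˡ s) ⟨
    (s ⁻¹ ∙ s) ∙ (a ∙ b) ≈⟨ interchange (s ⁻¹) a s b ⟨
    (s ⁻¹ ∙ a) ∙ (s ∙ b) ∎
    where
    a b : Carrier
    a = σ (negateOn S J) I
    b = σ S J
  σ-Δ-negateOn (s ∷ S) (inside  ∷ I) (outside ∷ J) =
    trans (∙-congˡ (σ-Δ-negateOn S I J)) (sym (assoc _ _ _))
  σ-Δ-negateOn (s ∷ S) (outside ∷ I) (inside  ∷ J) =
    trans (∙-congˡ (σ-Δ-negateOn S I J)) (x∙yz≈y∙xz _ _ _)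
  σ-Δ-negateOn (s ∷ S) (outside ∷ I) (outside ∷ J) = σ-Δ-negateOn S I J

  restrict : Vec Carrier m → (U : Subset m) → Vec Carrier ∣ U ∣
  restrict [] [] = []
  restrict (s ∷ S) (inside  ∷ U) = s ∷ restrict S U
  restrict (s ∷ S) (outside ∷ U) = restrict S U

  embed : (U : Subset m) → Subset ∣ U ∣ → Subset m
  embed [] [] = []
  embed (inside  ∷ U) (b ∷ K) = b ∷ embed U K
  embed (outside ∷ U) K = outside ∷ embed U K

  σ-restrict : ∀ (S : Vec Carrier m) U K → σ (restrict S U) K ≈ σ S (embed U K)
  σ-restrict [] [] [] = refl
  σ-restrict (s ∷ S) (inside  ∷ U) (inside  ∷ K) = ∙-congˡ (σ-restrict S U K)
  σ-restrict (s ∷ S) (inside  ∷ U) (outside ∷ K) = σ-restrict S U K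
  σ-restrict (s ∷ S) (outside ∷ U) K = σ-restrict S U K

  embed-⊆ : ∀ (U : Subset m) K → embed U K ⊆ U
  embed-⊆ (inside  ∷ U) (inside ∷ K) here = here
  embed-⊆ (inside  ∷ U) (_ ∷ K) (there x∈) = there (embed-⊆ U K x∈)
  embed-⊆ (outside ∷ U) K (there x∈) = there (embed-⊆ U K x∈)

  embed-nonempty : ∀ (U : Subset m) {K} → Nonempty K → Nonempty (embed U K)
  embed-nonempty (inside ∷ U) {inside ∷ K} (zero , here) = zero , here
  embed-nonempty (inside ∷ U) {_ ∷ K} (suc x , there x∈K) =
    let y , y∈ = embed-nonempty U (x , x∈K) in suc y , there y∈
  embed-nonempty (outside ∷ U) K≠∅ = let y , y∈ = embed-nonempty U K≠∅ in suc y , there y∈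

  davenport-subset : ∀ {d} → Defs.DavenportBound G d → (S : Vec Carrier m) (U : Subset m) →
    d ≤ ∣ U ∣ → ∃ λ J → J ⊆ U × Nonempty J × σ S J ≈ ε
  davenport-subset davenport S U d≤∣U∣ =
    let K , K≠∅ , σK≈ε = davenport ∣ U ∣ d≤∣U∣ (restrict S U)
    in embed U K , embed-⊆ U K , embed-nonempty U K≠∅ , trans (sym (σ-restrict S U K)) σK≈ε

module ZeroSums {c ℓ} (G : AbelianGroup c ℓ) {n : ℕ} (fin : FiniteOfOrder G n) where

  open import Data.Empty using (⊥; ⊥-elim)
  open import Data.Fin using (zero; suc)
  open import Data.Fin.Properties using (any?)
  open import Data.Fin.Subset using (_∉_; _⊆_; _⊂_; _∩_; _─_; _-_; ⁅_⁆; ∣_∣; Nonempty) renaming (⊥ to ∅)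
  open import Data.Fin.Subset.Properties
    using (_∈?_; _⊆?_; _⊂?_; nonempty?; anySubset?; ⊆-min; ⊆-trans; ⊆-antisym; ∉⊥; Empty-unique; ∩-comm;
           p─q⊆p; p∩q≢∅⇒p─q⊂p; x∈p∩q⁺; x∈p∩q⁻; x∈⁅x⁆; x∈⁅y⁆⇒x≡y; x∈p⇒p-x⊂p; x∈p∧x≢y⇒x∈p-y; x∈p∧x∉q⇒x∈p─q)
  open import Data.Fin.Subset.Induction using (Acc; acc; ⊂-wellFounded)
  open import Data.Nat using (_≤?_; s≤s)
  open import Data.Nat.Properties using (+-mono-≤; +-identityʳ; ≤-trans; ≤-reflexive; m≤n⇒m∸n≡0; ≰⇒>; module ≤-Reasoning)
  open import Data.Sum using (_⊎_; inj₁; inj₂; [_,_]′)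
  open import Data.Vec using ([]; _∷_)
  open import Function using (id; _∘_)
  open import Function.Bundles using (Inverse)
  open import Relation.Nullary using (yes; no; contradiction)
  open import Relation.Nullary.Decidable using (_×-dec_)
  open import Relation.Unary using (Pred; Decidable)
  open import Relation.Unary.Properties using (_∩?_; ∁?)
  import Relation.Binary as B

  import Defs
  open Defs using (DavenportBound)
  open Subsets
  open Counting
  open Parity
  open Arithmetic
  open AbelianGroup G hiding (_-_)
  open SubsetSums G
  open import Algebra.Properties.Group group
    using (identityˡ-unique; identityʳ-unique; inverseˡ-unique; inverseʳ-unique)
  import Relation.Binary.Reasoning.Setoid setoid as ≈-Reasoning

  private
    variable
      m : ℕ

  _≈?_ : B.Decidable _≈_
  _≈?_ = Defs._≈?_ G fin

  x∙x≈ε⇒x≈ε : ¬ 2 ∣ n → ∀ x → x ∙ x ≈ ε → x ≈ ε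
  x∙x≈ε⇒x≈ε odd x x∙x≈ε with x ≈? ε
  ... | yes x≈ε = x≈ε
  ... | no x≉ε = contradiction (fixpointFree-involution⇒even translate involutive fixpointFree) odd
    where
    open Inverse fin using (to; from; to-cong; from-cong; strictlyInverseˡ; strictlyInverseʳ)
    open ≈-Reasoning
    translate : Fin n → Fin n
    translate i = from (to i ∙ x)
    involutive : ∀ i → translate (translate i) ≡ i
    involutive i = ≡.trans (from-cong (begin
      to (from (to i ∙ x)) ∙ x ≈⟨ ∙-congʳ (strictlyInverseˡ _) ⟩
      (to i ∙ x) ∙ x           ≈⟨ assoc _ _ _ ⟩
      to i ∙ (x ∙ x)           ≈⟨ ∙-congˡ x∙x≈ε ⟩
      to i ∙ ε                 ≈⟨ identityʳ _ ⟩
      to i                     ∎)) (strictlyInverseʳ i)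
    fixpointFree : ∀ i → translate i ≢ i
    fixpointFree i eq = x≉ε (identityʳ-unique (to i) x (trans (sym (strictlyInverseˡ _)) (to-cong eq)))

  MinimalZeroSum : Vec Carrier m → Subset m → Set ℓ
  MinimalZeroSum = IsMinimalZeroSum G

  minimal-within : ∀ (S : Vec Carrier m) {L x} → σ S L ≈ ε → x ∈ L →
    ∃ λ A → A ⊆ L × MinimalZeroSum S A × x ∈ A
  minimal-within S {L} = go (⊂-wellFounded L)
    where
    go : ∀ {L x} → Acc _⊂_ L → σ S L ≈ ε → x ∈ L → ∃ λ A → A ⊆ L × MinimalZeroSum S A × x ∈ A
    go {L} {x} (acc smaller) σL≈ε x∈L
      with anySubset? (λ J → J ⊂? L ×-dec nonempty? J ×-dec σ S J ≈? ε)
    ... | no ∄J = L , id , ((x , x∈L) , σL≈ε , λ J J⊂L J≠∅ σJ≈ε → ∄J (J , J⊂L , J≠∅ , σJ≈ε)) , x∈L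
    ... | yes (J , J⊂L@(J⊆L , _) , (y , y∈J) , σJ≈ε) with x ∈? J
    ...   | yes x∈J = let A , A⊆J , minA , x∈A = go (smaller J⊂L) σJ≈ε x∈J in
                      A , ⊆-trans A⊆J J⊆L , minA , x∈A
    ...   | no x∉J = let A , A⊆L─J , minA , x∈A = go (smaller L─J⊂L) σL─J≈ε (x∈p∧x∉q⇒x∈p─q x∈L x∉J) in
                     A , ⊆-trans A⊆L─J (p─q⊆p L J) , minA , x∈A
      where
      L─J⊂L : L ─ J ⊂ L
      L─J⊂L = p∩q≢∅⇒p─q⊂p L J (y , x∈p∩q⁺ (J⊆L y∈J , y∈J))
      σL─J≈ε : σ S (L ─ J) ≈ ε
      σL─J≈ε = identityʳ-unique (σ S J) _ (trans (sym (σ-split-⊆ S J⊆L)) (trans σL≈ε (sym σJ≈ε)))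

  minimal-⊆⇒≡ : ∀ (S : Vec Carrier m) {A C} → MinimalZeroSum S A → C ⊆ A → Nonempty C → σ S C ≈ ε → C ≡ A
  minimal-⊆⇒≡ S {A} {C} (_ , _ , no-smaller) C⊆A C≠∅ σC≈ε with C ≟ A
  ... | yes C≡A = C≡A
  ... | no C≢A = ⊥-elim (no-smaller C (⊆∧≢⇒⊂ C⊆A C≢A) C≠∅ σC≈ε)

  SumsTo : Vec Carrier m → Subset m → Carrier → Pred (Subset m) ℓ
  SumsTo S U g I = I ⊆ U × σ S I ≈ g

  sumsTo? : ∀ (S : Vec Carrier m) U g → Decidable (SumsTo S U g)
  sumsTo? S U g I = I ⊆? U ×-dec σ S I ≈? g

  #SumsTo : Vec Carrier m → Subset m → Carrier → ℕ
  #SumsTo S U g = count (sumsTo? S U g)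

  #ZeroSumsThrough #ZeroSumsAvoiding : Vec Carrier m → Subset m → Fin m → ℕ
  #ZeroSumsThrough S U x = count (sumsTo? S U ε ∩? (x ∈?_))
  #ZeroSumsAvoiding S U x = count (sumsTo? S U ε ∩? ∁? (x ∈?_))

  #SumsTo-negateOn : ∀ (S : Vec Carrier m) {U J g} → J ⊆ U → σ S J ≈ g →
    #SumsTo S U g ≡ #SumsTo (negateOn S J) U ε
  #SumsTo-negateOn S {U} {J} {g} J⊆U σJ≈g = ≡.trans (count-Δ (sumsTo? S U g) J)
    (count-cong _ (sumsTo? (negateOn S J) U ε)
      (λ I (IΔJ⊆U , σIΔJ≈g) → ⊆-Δ⁻ IΔJ⊆U J⊆U ,
         identityˡ-unique _ (σ S J) (trans (sym (σ-Δ-negateOn S I J)) (trans σIΔJ≈g (sym σJ≈g))))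
      (λ I (I⊆U , σ'I≈ε) → ⊆-Δ I⊆U J⊆U ,
         trans (σ-Δ-negateOn S I J) (trans (∙-cong σ'I≈ε σJ≈g) (identityˡ g))))

  #ZeroSumsAvoiding≡#ZeroSums-remove : ∀ (S : Vec Carrier m) U x →
    #ZeroSumsAvoiding S U x ≡ #SumsTo S (U - x) ε
  #ZeroSumsAvoiding≡#ZeroSums-remove S U x = count-cong (sumsTo? S U ε ∩? ∁? (x ∈?_)) (sumsTo? S (U - x) ε)
    (λ I ((I⊆U , σI≈ε) , x∉I) → (λ t∈I → x∈p∧x≢y⇒x∈p-y (I⊆U t∈I) λ { ≡.refl → x∉I t∈I }) , σI≈ε)
    (λ I (I⊆U-x , σI≈ε) → (p─q⊆p U ⁅ x ⁆ ∘ I⊆U-x , σI≈ε) , λ x∈I → proj₂ (x∈p-y⁻ (I⊆U-x x∈I)) ≡.refl)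

  #ZeroSumsThrough≡#SumsTo-remove : ∀ (S : Vec Carrier m) {U x} → x ∈ U →
    #ZeroSumsThrough S U x ≡ #SumsTo S (U - x) (lookup S x ⁻¹)
  #ZeroSumsThrough≡#SumsTo-remove S {U} {x} x∈U = ≡.trans (count-Δ (sumsTo? S U ε ∩? (x ∈?_)) ⁅ x ⁆)
    (count-cong _ (sumsTo? S (U - x) (lookup S x ⁻¹)) forward backward)
    where
    disjoint : ∀ {I} → x ∉ I → Disjoint I ⁅ x ⁆
    disjoint x∉I t∈I t∈⁅x⁆ rewrite x∈⁅y⁆⇒x≡y x t∈⁅x⁆ = x∉I t∈I
    x∉ : ∀ {I} → x ∈ I Δ ⁅ x ⁆ → x ∉ I
    x∉ {I} x∈IΔx with x∈pΔq⁻ I ⁅ x ⁆ x∈IΔx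
    ... | inj₁ (_ , x∉⁅x⁆) = ⊥-elim (x∉⁅x⁆ (x∈⁅x⁆ x))
    ... | inj₂ (_ , x∉I) = x∉I
    forward : ∀ I → SumsTo S U ε (I Δ ⁅ x ⁆) × x ∈ I Δ ⁅ x ⁆ → SumsTo S (U - x) (lookup S x ⁻¹) I
    forward I ((IΔx⊆U , σIΔx≈ε) , x∈IΔx) =
      (λ {t} t∈I → x∈p∧x≢y⇒x∈p-y (IΔx⊆U (x∈pΔq⁺ (inj₁ (t∈I , λ t∈⁅x⁆ → disjoint (x∉ x∈IΔx) t∈I t∈⁅x⁆))))
                                 (λ { ≡.refl → x∉ x∈IΔx t∈I })) ,
      inverseˡ-unique _ _ (trans (∙-congˡ (sym (σ-⁅⁆ S x))) (trans (sym (σ-Δ-disjoint S (disjoint (x∉ x∈IΔx)))) σIΔx≈ε))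
    backward : ∀ I → SumsTo S (U - x) (lookup S x ⁻¹) I → SumsTo S U ε (I Δ ⁅ x ⁆) × x ∈ I Δ ⁅ x ⁆
    backward I (I⊆U-x , σI≈-x) =
      (⊆-Δ (p─q⊆p U ⁅ x ⁆ ∘ I⊆U-x) (⁅x⁆⊆p x∈U) ,
       trans (σ-Δ-disjoint S (disjoint x∉I)) (trans (∙-cong σI≈-x (σ-⁅⁆ S x)) (inverseˡ _))) ,
      x∈pΔq⁺ (inj₂ (x∈⁅x⁆ x , x∉I))
      where x∉I = λ x∈I → proj₂ (x∈p-y⁻ (I⊆U-x x∈I)) ≡.refl

  #ZeroSums-split : ∀ (S : Vec Carrier m) {U x} → x ∈ U →
    #SumsTo S U ε ≡ #SumsTo S (U - x) (lookup S x ⁻¹) + #SumsTo S (U - x) ε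
  #ZeroSums-split S {U} {x} x∈U = ≡.trans (count-split (sumsTo? S U ε) (x ∈?_))
    (≡.cong₂ _+_ (#ZeroSumsThrough≡#SumsTo-remove S x∈U) (#ZeroSumsAvoiding≡#ZeroSums-remove S U x))

  InZeroSum : Vec Carrier m → Subset m → Fin m → Set ℓ
  InZeroSum S U x = ∃ λ L → SumsTo S U ε L × x ∈ L

  UniqueMinimalThrough : Vec Carrier m → Subset m → Set ℓ
  UniqueMinimalThrough S U = ∀ {x A B} → A ⊆ U → B ⊆ U → MinimalZeroSum S A → MinimalZeroSum S B →
    x ∈ A → x ∈ B → A ≡ B

  Extremal : ℕ → Vec Carrier m → Subset m → Set
  Extremal d S U = #SumsTo S U ε ≡ 2 ^ (suc ∣ U ∣ ∸ d)

  module _ {d : ℕ} (davenport : DavenportBound G d) where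

    #ZeroSums-lowerBound-acc : ∀ {U : Subset m} → Acc _⊂_ U → ∀ S →
      2 ^ (suc ∣ U ∣ ∸ d) ≤ #SumsTo S U ε
    #ZeroSums-lowerBound-acc {U = U} (acc smaller) S with d ≤? ∣ U ∣
    ... | no d≰∣U∣ = ≤-trans (≤-reflexive (≡.cong (2 ^_) (m≤n⇒m∸n≡0 (≰⇒> d≰∣U∣))))
                             (count-pos (sumsTo? S U ε) (⊆-min U , σ-∅ S))
    ... | yes d≤∣U∣ with davenport-subset davenport S U d≤∣U∣
    ...   | J , J⊆U , (x , x∈J) , σJ≈ε = begin
      2 ^ (suc ∣ U ∣ ∸ d)
        ≤⟨ 2^[1+k∸d]≤2^[k∸d]+2^[k∸d] ∣ U ∣ d ⟩
      2 ^ (∣ U ∣ ∸ d) + 2 ^ (∣ U ∣ ∸ d)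
        ≡⟨ ≡.cong (λ k → 2 ^ (k ∸ d) + 2 ^ (k ∸ d)) (∣p∣≡1+∣p-x∣ x∈U) ⟩
      2 ^ (suc ∣ U - x ∣ ∸ d) + 2 ^ (suc ∣ U - x ∣ ∸ d)
        ≤⟨ +-mono-≤ (#ZeroSums-lowerBound-acc (smaller (x∈p⇒p-x⊂p x∈U)) (negateOn S (J - x)))
                    (#ZeroSums-lowerBound-acc (smaller (x∈p⇒p-x⊂p x∈U)) S) ⟩
      #SumsTo (negateOn S (J - x)) (U - x) ε + #SumsTo S (U - x) ε
        ≡⟨ ≡.cong (_+ #SumsTo S (U - x) ε) (#SumsTo-negateOn S (p⊆q⇒p-x⊆q-x J⊆U) σ[J-x]≈-x) ⟨
      #SumsTo S (U - x) (lookup S x ⁻¹) + #SumsTo S (U - x) ε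
        ≡⟨ #ZeroSums-split S x∈U ⟨
      #SumsTo S U ε ∎
      where
      open ≤-Reasoning
      x∈U : x ∈ U
      x∈U = J⊆U x∈J
      σ[J-x]≈-x : σ S (J - x) ≈ lookup S x ⁻¹
      σ[J-x]≈-x = inverseʳ-unique _ _ (trans (sym (σ-remove S x∈J)) σJ≈ε)

    #SumsTo-lowerBound : ∀ (S : Vec Carrier m) {U J g} → J ⊆ U → σ S J ≈ g →
      2 ^ (suc ∣ U ∣ ∸ d) ≤ #SumsTo S U g
    #SumsTo-lowerBound S {U} {J} {g} J⊆U σJ≈g = begin
      2 ^ (suc ∣ U ∣ ∸ d)        ≤⟨ #ZeroSums-lowerBound-acc (⊂-wellFounded U) (negateOn S J) ⟩
      #SumsTo (negateOn S J) U ε ≡⟨ #SumsTo-negateOn S J⊆U σJ≈g ⟨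
      #SumsTo S U g              ∎
      where open ≤-Reasoning

    extremal-halves : ∀ (S : Vec Carrier m) {U x} → Extremal d S U → InZeroSum S U x →
      #ZeroSumsThrough S U x ≡ 2 ^ (∣ U ∣ ∸ d) × #ZeroSumsAvoiding S U x ≡ 2 ^ (∣ U ∣ ∸ d)
    extremal-halves S {U} {x} extremal (L , (L⊆U , σL≈ε) , x∈L) = +-squeeze through≥ avoiding≥ (begin
      #ZeroSumsThrough S U x + #ZeroSumsAvoiding S U x ≡⟨ count-split (sumsTo? S U ε) (x ∈?_) ⟨
      #SumsTo S U ε                                    ≡⟨ extremal ⟩
      2 ^ (suc ∣ U ∣ ∸ d)                              ≤⟨ 2^[1+k∸d]≤2^[k∸d]+2^[k∸d] ∣ U ∣ d ⟩
      2 ^ (∣ U ∣ ∸ d) + 2 ^ (∣ U ∣ ∸ d)                ∎)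
      where
      open ≤-Reasoning
      x∈U : x ∈ U
      x∈U = L⊆U x∈L
      half≡ : 2 ^ (suc ∣ U - x ∣ ∸ d) ≡ 2 ^ (∣ U ∣ ∸ d)
      half≡ = ≡.cong (λ k → 2 ^ (k ∸ d)) (≡.sym (∣p∣≡1+∣p-x∣ x∈U))
      through≥ : 2 ^ (∣ U ∣ ∸ d) ≤ #ZeroSumsThrough S U x
      through≥ = begin
        2 ^ (∣ U ∣ ∸ d)                   ≡⟨ half≡ ⟨
        2 ^ (suc ∣ U - x ∣ ∸ d)           ≤⟨ #SumsTo-lowerBound S (p⊆q⇒p-x⊆q-x L⊆U)
                                               (inverseʳ-unique _ _ (trans (sym (σ-remove S x∈L)) σL≈ε)) ⟩
        #SumsTo S (U - x) (lookup S x ⁻¹) ≡⟨ #ZeroSumsThrough≡#SumsTo-remove S x∈U ⟨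
        #ZeroSumsThrough S U x            ∎
      avoiding≥ : 2 ^ (∣ U ∣ ∸ d) ≤ #ZeroSumsAvoiding S U x
      avoiding≥ = begin
        2 ^ (∣ U ∣ ∸ d)         ≡⟨ half≡ ⟨
        2 ^ (suc ∣ U - x ∣ ∸ d) ≤⟨ #SumsTo-lowerBound S (⊆-min (U - x)) (σ-∅ S) ⟩
        #SumsTo S (U - x) ε     ≡⟨ #ZeroSumsAvoiding≡#ZeroSums-remove S U x ⟨
        #ZeroSumsAvoiding S U x ∎

    extremal-remove : ∀ (S : Vec Carrier m) {U x} → Extremal d S U → InZeroSum S U x →
      Extremal d S (U - x)
    extremal-remove S {U} {x} extremal inZeroSum@(_ , (L⊆U , _) , x∈L) = begin
      #SumsTo S (U - x) ε     ≡⟨ #ZeroSumsAvoiding≡#ZeroSums-remove S U x ⟨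
      #ZeroSumsAvoiding S U x ≡⟨ proj₂ (extremal-halves S extremal inZeroSum) ⟩
      2 ^ (∣ U ∣ ∸ d)         ≡⟨ ≡.cong (λ k → 2 ^ (k ∸ d)) (∣p∣≡1+∣p-x∣ (L⊆U x∈L)) ⟩
      2 ^ (suc ∣ U - x ∣ ∸ d) ∎
      where open ≡.≡-Reasoning

    module TwoMinimalsThrough (odd : ¬ 2 ∣ n) (S : Vec Carrier m) {U} (extremal : Extremal d S U)
      (unique-remove : ∀ {q} → InZeroSum S U q → UniqueMinimalThrough S (U - q))
      {A B y} (A⊆U : A ⊆ U) (B⊆U : B ⊆ U) (minA : MinimalZeroSum S A) (minB : MinimalZeroSum S B)
      (y∈A : y ∈ A) (y∈B : y ∈ B) (A≢B : A ≢ B) where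

      σA≈ε : σ S A ≈ ε
      σA≈ε = proj₁ (proj₂ minA)
      σB≈ε : σ S B ≈ ε
      σB≈ε = proj₁ (proj₂ minB)

      minimal⇒inZeroSum : ∀ {C t} → C ⊆ U → MinimalZeroSum S C → t ∈ C → InZeroSum S U t
      minimal⇒inZeroSum C⊆U (_ , σC≈ε , _) t∈C = _ , (C⊆U , σC≈ε) , t∈C

      inZeroSum⇒∈A⊎∈B : ∀ {t} → InZeroSum S U t → t ∈ A ⊎ t ∈ B
      inZeroSum⇒∈A⊎∈B {t} t-in with t ∈? A | t ∈? B
      ... | yes t∈A | _ = inj₁ t∈A
      ... | no _ | yes t∈B = inj₂ t∈B
      ... | no t∉A | no t∉B =
        ⊥-elim (A≢B (unique-remove t-in (⊆-remove A⊆U t∉A) (⊆-remove B⊆U t∉B) minA minB y∈A y∈B))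

      ∈A∖B : ∃ λ x → x ∈ A × x ∉ B
      ∈A∖B = ⊈⇒∃∉ λ A⊆B → A≢B (minimal-⊆⇒≡ S minB A⊆B (y , y∈A) σA≈ε)

      ∈B∖A : ∃ λ z → z ∈ B × z ∉ A
      ∈B∖A = ⊈⇒∃∉ λ B⊆A → A≢B (≡.sym (minimal-⊆⇒≡ S minA B⊆A (y , y∈B) σB≈ε))

      x z : Fin m
      x = proj₁ ∈A∖B
      z = proj₁ ∈B∖A
      x∈A : x ∈ A
      x∈A = proj₁ (proj₂ ∈A∖B)
      x∉B : x ∉ B
      x∉B = proj₂ (proj₂ ∈A∖B)
      z∈B : z ∈ B
      z∈B = proj₁ (proj₂ ∈B∖A)
      z∉A : z ∉ A
      z∉A = proj₂ (proj₂ ∈B∖A)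

      -- The zero-sum subsets avoiding x and those avoiding y are equally many, and B avoids x but
      -- not y; hence some zero-sum subset avoids y but contains x.
      third : ∃ λ R → R ⊆ U × MinimalZeroSum S R × x ∈ R × y ∉ R
      third with count-exchange (sumsTo? S U ε ∩? ∁? (x ∈?_)) (sumsTo? S U ε ∩? ∁? (y ∈?_))
                   (≡.trans (proj₂ (extremal-halves S extremal (minimal⇒inZeroSum A⊆U minA x∈A)))
                            (≡.sym (proj₂ (extremal-halves S extremal (minimal⇒inZeroSum A⊆U minA y∈A)))))
                   ((B⊆U , σB≈ε) , x∉B) (λ (_ , y∉B) → y∉B y∈B)
      ... | M , ((M⊆U , σM≈ε) , y∉M) , ¬M-avoids-x with x ∈? M
      ...   | no x∉M = ⊥-elim (¬M-avoids-x ((M⊆U , σM≈ε) , x∉M))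
      ...   | yes x∈M = let R , R⊆M , minR , x∈R = minimal-within S σM≈ε x∈M in
                        R , ⊆-trans R⊆M M⊆U , minR , x∈R , y∉M ∘ R⊆M

      module _ {R} (R⊆U : R ⊆ U) (minR : MinimalZeroSum S R) (x∈R : x ∈ R) (y∉R : y ∉ R) where

        σR≈ε : σ S R ≈ ε
        σR≈ε = proj₁ (proj₂ minR)

        R≢ : ∀ {C} → y ∈ C → R ≢ C
        R≢ y∈C R≡C = y∉R (≡.subst (y ∈_) (≡.sym R≡C) y∈C)

        B∖A⊆R : ∀ {t} → t ∈ B → t ∉ A → t ∈ R
        B∖A⊆R {t} t∈B t∉A with t ∈? R
        ... | yes t∈R = t∈R
        ... | no t∉R = ⊥-elim (R≢ y∈A (unique-remove (minimal⇒inZeroSum B⊆U minB t∈B)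
                          (⊆-remove R⊆U t∉R) (⊆-remove A⊆U t∉A) minR minA x∈R x∈A))

        A∖B⊆R : ∀ {t} → t ∈ A → t ∉ B → t ∈ R
        A∖B⊆R {t} t∈A t∉B with t ∈? R
        ... | yes t∈R = t∈R
        ... | no t∉R = ⊥-elim (R≢ y∈B (unique-remove (minimal⇒inZeroSum A⊆U minA t∈A)
                          (⊆-remove R⊆U t∉R) (⊆-remove B⊆U t∉B) minR minB (B∖A⊆R z∈B z∉A) z∈B))

        -- Without a common point, R = (A ─ B) ∪ (B ─ A) and both parts sum to σ (A ∩ B) ⁻¹; so
        -- σ (A ─ B) has order at most 2, and by odd order A ─ B is a proper zero-sum subset of A.
        no-common-point : ¬ (∀ {w} → w ∈ R → w ∈ A → w ∉ B)
        no-common-point R∩A∩B=∅ = x∈p─q⇒x∉q (≡.subst (y ∈_) (≡.sym A─B≡A) y∈A) y∈B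
          where
          R∩A≡A─B : R ∩ A ≡ A ─ B
          R∩A≡A─B = ⊆-antisym
            (λ w∈R∩A → let w∈R , w∈A = x∈p∩q⁻ R A w∈R∩A in x∈p∧x∉q⇒x∈p─q w∈A (R∩A∩B=∅ w∈R w∈A))
            (λ w∈A─B → x∈p∩q⁺ (A∖B⊆R (p─q⊆p A B w∈A─B) (x∈p─q⇒x∉q w∈A─B) , p─q⊆p A B w∈A─B))
          in-B : ∀ {w} → w ∈ A ⊎ w ∈ B → w ∉ A → w ∈ B
          in-B (inj₁ w∈A) w∉A = ⊥-elim (w∉A w∈A)
          in-B (inj₂ w∈B) _ = w∈B
          R─A≡B─A : R ─ A ≡ B ─ A
          R─A≡B─A = ⊆-antisym
            (λ w∈R─A → let w∈R = p─q⊆p R A w∈R─A ; w∉A = x∈p─q⇒x∉q w∈R─A in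
              x∈p∧x∉q⇒x∈p─q (in-B (inZeroSum⇒∈A⊎∈B (minimal⇒inZeroSum R⊆U minR w∈R)) w∉A) w∉A)
            (λ w∈B─A → x∈p∧x∉q⇒x∈p─q (B∖A⊆R (p─q⊆p B A w∈B─A) (x∈p─q⇒x∉q w∈B─A)) (x∈p─q⇒x∉q w∈B─A))
          s : Carrier
          s = σ S (A ∩ B)
          σA─B≈s⁻¹ : σ S (A ─ B) ≈ s ⁻¹
          σA─B≈s⁻¹ = inverseʳ-unique s _ (trans (sym (σ-split S A B)) σA≈ε)
          σB─A≈s⁻¹ : σ S (B ─ A) ≈ s ⁻¹
          σB─A≈s⁻¹ = inverseʳ-unique s _
            (trans (∙-congʳ (reflexive (≡.cong (σ S) (∩-comm A B)))) (trans (sym (σ-split S B A)) σB≈ε))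
          σA─B∙σA─B≈ε : σ S (A ─ B) ∙ σ S (A ─ B) ≈ ε
          σA─B∙σA─B≈ε = begin
            σ S (A ─ B) ∙ σ S (A ─ B) ≈⟨ ∙-congˡ (trans σA─B≈s⁻¹ (sym σB─A≈s⁻¹)) ⟩
            σ S (A ─ B) ∙ σ S (B ─ A) ≡⟨ ≡.cong₂ (λ I J → σ S I ∙ σ S J) R∩A≡A─B R─A≡B─A ⟨
            σ S (R ∩ A) ∙ σ S (R ─ A) ≈⟨ σ-split S R A ⟨
            σ S R                     ≈⟨ σR≈ε ⟩
            ε                         ∎
            where open ≈-Reasoning
          A─B≡A : A ─ B ≡ A
          A─B≡A = minimal-⊆⇒≡ S minA (p─q⊆p A B) (x , x∈p∧x∉q⇒x∈p─q x∈A x∉B)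
                    (x∙x≈ε⇒x≈ε odd _ σA─B∙σA─B≈ε)

        avoiding-y⇒⊆R : ∀ {L} → SumsTo S U ε L → y ∉ L → L ⊆ R
        avoiding-y⇒⊆R {L} (L⊆U , σL≈ε) y∉L {t} t∈L with minimal-within S σL≈ε t∈L
        ... | R′ , R′⊆L , minR′ , t∈R′ with any? (λ s → s ∈? R′ ×-dec s ∈? R)
        ...   | yes (s , s∈R′ , s∈R) = ≡.subst (t ∈_) R′≡R t∈R′
          where
          R′≡R : R′ ≡ R
          R′≡R = unique-remove (minimal⇒inZeroSum A⊆U minA y∈A)
                   (⊆-remove (⊆-trans R′⊆L L⊆U) (y∉L ∘ R′⊆L)) (⊆-remove R⊆U y∉R) minR′ minR s∈R′ s∈R
        ...   | no R′∩R=∅ = ⊥-elim (R′∩R=∅ (x , ≡.subst (x ∈_) (≡.sym R′≡A) x∈A , x∈R))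
          where
          R′⊆A : R′ ⊆ A
          R′⊆A {s} s∈R′ with s ∈? A | inZeroSum⇒∈A⊎∈B (minimal⇒inZeroSum (⊆-trans R′⊆L L⊆U) minR′ s∈R′)
          ... | yes s∈A | _ = s∈A
          ... | no s∉A | inj₁ s∈A = ⊥-elim (s∉A s∈A)
          ... | no s∉A | inj₂ s∈B = ⊥-elim (R′∩R=∅ (s , s∈R′ , B∖A⊆R s∈B s∉A))
          R′≡A : R′ ≡ A
          R′≡A = minimal-⊆⇒≡ S minA R′⊆A (t , t∈R′) (proj₁ (proj₂ minR′))

        #ZeroSumsAvoiding-y≡2 : #ZeroSumsAvoiding S U y ≡ 2
        #ZeroSumsAvoiding-y≡2 = ≡.trans (count-split avoiding-y nonempty?) (≡.cong₂ _+_
          (count-unique (avoiding-y ∩? nonempty?) (((R⊆U , σR≈ε) , y∉R) , (x , x∈R))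
            (λ L ((L-zs@(_ , σL≈ε) , y∉L) , L≠∅) → minimal-⊆⇒≡ S minR (avoiding-y⇒⊆R L-zs y∉L) L≠∅ σL≈ε))
          (count-unique (avoiding-y ∩? ∁? nonempty?) (((⊆-min U , σ-∅ S) , ∉⊥) , λ (_ , t∈∅) → ∉⊥ t∈∅)
            (λ L (_ , L-empty) → Empty-unique L-empty)))
          where
          avoiding-y : Decidable (λ I → SumsTo S U ε I × y ∉ I)
          avoiding-y = sumsTo? S U ε ∩? ∁? (y ∈?_)

        3≤#ZeroSumsThrough : ∀ {w} → w ∈ R → w ∈ A → w ∈ B → 3 ≤ #ZeroSumsThrough S U w
        3≤#ZeroSumsThrough {w} w∈R w∈A w∈B = begin
          3                             ≤⟨ s≤s (s≤s (count-pos through∖A∖B R-through∖A∖B)) ⟩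
          suc (suc (count through∖A∖B)) ≡⟨ ≡.cong suc (count-remove through∖A B-through∖A) ⟨
          suc (count through∖A)         ≡⟨ count-remove through A-through ⟨
          count through                 ∎
          where
          open ≤-Reasoning
          through : Decidable (λ I → SumsTo S U ε I × w ∈ I)
          through = sumsTo? S U ε ∩? (w ∈?_)
          through∖A : Decidable (λ I → (SumsTo S U ε I × w ∈ I) × I ≢ A)
          through∖A = through ∩? ∁? (_≟ A)
          through∖A∖B : Decidable (λ I → ((SumsTo S U ε I × w ∈ I) × I ≢ A) × I ≢ B)
          through∖A∖B = through∖A ∩? ∁? (_≟ B)
          A-through : SumsTo S U ε A × w ∈ A
          A-through = (A⊆U , σA≈ε) , w∈A
          B-through∖A : (SumsTo S U ε B × w ∈ B) × B ≢ A
          B-through∖A = ((B⊆U , σB≈ε) , w∈B) , A≢B ∘ ≡.sym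
          R-through∖A∖B : ((SumsTo S U ε R × w ∈ R) × R ≢ A) × R ≢ B
          R-through∖A∖B = (((R⊆U , σR≈ε) , w∈R) , R≢ y∈A) , R≢ y∈B

        -- R, A and B pass through w while only ∅ and R avoid y, yet both counts are 2 ^ (∣ U ∣ ∸ d).
        common-point : ∀ {w} → w ∈ R → w ∈ A → w ∈ B → ⊥
        common-point {w} w∈R w∈A w∈B = 3≰2 (begin
          3                       ≤⟨ 3≤#ZeroSumsThrough w∈R w∈A w∈B ⟩
          #ZeroSumsThrough S U w  ≡⟨ proj₁ (extremal-halves S extremal (minimal⇒inZeroSum A⊆U minA w∈A)) ⟩
          2 ^ (∣ U ∣ ∸ d)         ≡⟨ proj₂ (extremal-halves S extremal (minimal⇒inZeroSum A⊆U minA y∈A)) ⟨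
          #ZeroSumsAvoiding S U y ≡⟨ #ZeroSumsAvoiding-y≡2 ⟩
          2                       ∎)
          where
          open ≤-Reasoning
          3≰2 : ¬ 3 ≤ 2
          3≰2 (s≤s (s≤s ()))

      impossible : ⊥
      impossible with third
      ... | R , R⊆U , minR , x∈R , y∉R with any? (λ w → w ∈? R ×-dec w ∈? A ×-dec w ∈? B)
      ...   | yes (w , w∈R , w∈A , w∈B) = common-point R⊆U minR x∈R y∉R w∈R w∈A w∈B
      ...   | no ∄w =
        no-common-point R⊆U minR x∈R y∉R (λ w∈R w∈A w∈B → ∄w (_ , w∈R , w∈A , w∈B))

    unique-minimal-through : ¬ 2 ∣ n → ∀ (S : Vec Carrier m) {U} → Extremal d S U →
      UniqueMinimalThrough S U
    unique-minimal-through odd S {U} = go (⊂-wellFounded U)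
      where
      go : ∀ {U} → Acc _⊂_ U → Extremal d S U → UniqueMinimalThrough S U
      go {U} (acc smaller) extremal {A = A} {B} A⊆U B⊆U minA minB y∈A y∈B with A ≟ B
      ... | yes A≡B = A≡B
      ... | no A≢B = ⊥-elim (TwoMinimalsThrough.impossible odd S extremal
        (λ q-in@(_ , (L⊆U , _) , q∈L) →
          go (smaller (x∈p⇒p-x⊂p (L⊆U q∈L))) (extremal-remove S extremal q-in))
        A⊆U B⊆U minA minB y∈A y∈B A≢B)

  record Decomposition (S : Vec Carrier m) (U : Subset m) (r : ℕ) : Set ℓ where
    field
      part : Vec (Subset m) r
      part-minimal : ∀ i → MinimalZeroSum S (lookup part i)
      part-⊆ : ∀ i → lookup part i ⊆ U
      part-disjoint : ∀ {i j} → i ≢ j → Disjoint (lookup part i) (lookup part j)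
      part-cover : ∀ {x} → x ∈ U → ∃ λ i → x ∈ lookup part i
      #ZeroSums≡2^r : #SumsTo S U ε ≡ 2 ^ r

  module _ (S : Vec Carrier m) (unique : UniqueMinimalThrough S full) where

    minimal⊆zeroSum : ∀ {L A x} → σ S L ≈ ε → MinimalZeroSum S A → x ∈ L → x ∈ A → A ⊆ L
    minimal⊆zeroSum σL≈ε minA x∈L x∈A with minimal-within S σL≈ε x∈L
    ... | R , R⊆L , minR , x∈R = ≡.subst (_⊆ _) (unique (⊆-max R) (⊆-max _) minR minA x∈R x∈A) R⊆L

    #ZeroSums-block : ∀ {U A x} → A ⊆ U → MinimalZeroSum S A → x ∈ A →
      #SumsTo S U ε ≡ #SumsTo S (U ─ A) ε + #SumsTo S (U ─ A) ε
    #ZeroSums-block {U} {A} {x} A⊆U minA@(_ , σA≈ε , _) x∈A =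
      ≡.trans (count-split (sumsTo? S U ε) (x ∈?_)) (≡.cong₂ _+_ through avoiding)
      where
      ⊆U─A : ∀ {I} → I ⊆ U → Disjoint I A → I ⊆ U ─ A
      ⊆U─A I⊆U I∩A=∅ t∈I = x∈p∧x∉q⇒x∈p─q (I⊆U t∈I) (I∩A=∅ t∈I)
      ⊆U─A⇒disjoint : ∀ {I} → I ⊆ U ─ A → Disjoint I A
      ⊆U─A⇒disjoint I⊆U─A t∈I = x∈p─q⇒x∉q (I⊆U─A t∈I)
      ΔA-disjoint : ∀ {I} → σ S (I Δ A) ≈ ε → x ∈ I Δ A → Disjoint I A
      ΔA-disjoint {I} σIΔA≈ε x∈IΔA {t} t∈I t∈A with x∈pΔq⁻ I A (minimal⊆zeroSum σIΔA≈ε minA x∈IΔA x∈A t∈A)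
      ... | inj₁ (_ , t∉A) = t∉A t∈A
      ... | inj₂ (_ , t∉I) = t∉I t∈I
      through : #ZeroSumsThrough S U x ≡ #SumsTo S (U ─ A) ε
      through = ≡.trans (count-Δ (sumsTo? S U ε ∩? (x ∈?_)) A) (count-cong _ (sumsTo? S (U ─ A) ε)
        (λ I ((IΔA⊆U , σIΔA≈ε) , x∈IΔA) → let I∩A=∅ = ΔA-disjoint σIΔA≈ε x∈IΔA in
          ⊆U─A (⊆-Δ⁻ IΔA⊆U A⊆U) I∩A=∅ ,
          identityʳ-unique (σ S A) _ (trans (comm _ _)
            (trans (sym (σ-Δ-disjoint S I∩A=∅)) (trans σIΔA≈ε (sym σA≈ε)))))
        (λ I (I⊆U─A , σI≈ε) → let I∩A=∅ = ⊆U─A⇒disjoint I⊆U─A in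
          (⊆-Δ (p─q⊆p U A ∘ I⊆U─A) A⊆U ,
           trans (σ-Δ-disjoint S I∩A=∅) (trans (∙-cong σI≈ε σA≈ε) (identityˡ ε))) ,
          x∈pΔq⁺ (inj₂ (x∈A , λ x∈I → I∩A=∅ x∈I x∈A))))
      avoiding : #ZeroSumsAvoiding S U x ≡ #SumsTo S (U ─ A) ε
      avoiding = count-cong _ (sumsTo? S (U ─ A) ε)
        (λ I ((I⊆U , σI≈ε) , x∉I) →
          ⊆U─A I⊆U (λ t∈I t∈A → x∉I (minimal⊆zeroSum σI≈ε minA t∈I t∈A x∈A)) , σI≈ε)
        (λ I (I⊆U─A , σI≈ε) → (p─q⊆p U A ∘ I⊆U─A , σI≈ε) , λ x∈I → ⊆U─A⇒disjoint I⊆U─A x∈I x∈A)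

    Saturated : Subset m → Set ℓ
    Saturated U = ∀ {x} → x ∈ U → ∃ λ A → A ⊆ U × MinimalZeroSum S A × x ∈ A

    saturated-─ : ∀ {U A} → Saturated U → MinimalZeroSum S A → Saturated (U ─ A)
    saturated-─ {U} {A} saturated minA {t} t∈U─A with saturated (p─q⊆p U A t∈U─A)
    ... | B , B⊆U , minB , t∈B = B , B⊆U─A , minB , t∈B
      where
      B⊆U─A : B ⊆ U ─ A
      B⊆U─A s∈B = x∈p∧x∉q⇒x∈p─q (B⊆U s∈B) λ s∈A →
        x∈p─q⇒x∉q t∈U─A (≡.subst (t ∈_) (unique (⊆-max B) (⊆-max A) minB minA s∈B s∈A) t∈B)

    decomposition-∅ : ∀ {U} → ¬ Nonempty U → Decomposition S U 0
    decomposition-∅ {U} U-empty = record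
      { part = []
      ; part-minimal = λ ()
      ; part-⊆ = λ ()
      ; part-disjoint = λ { {()} }
      ; part-cover = λ x∈U → ⊥-elim (U-empty (_ , x∈U))
      ; #ZeroSums≡2^r = count-unique (sumsTo? S U ε) (⊆-min U , σ-∅ S)
          (λ I (I⊆U , _) → Empty-unique λ (t , t∈I) → U-empty (t , I⊆U t∈I))
      }

    decomposition-∷ : ∀ {U A x r} → A ⊆ U → MinimalZeroSum S A → x ∈ A →
      Decomposition S (U ─ A) r → Decomposition S U (suc r)
    decomposition-∷ {U} {A} {r = r} A⊆U minA x∈A D = record
      { part = A ∷ part
      ; part-minimal = λ { zero → minA ; (suc i) → part-minimal i }
      ; part-⊆ = λ { zero → A⊆U ; (suc i) → p─q⊆p U A ∘ part-⊆ i }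
      ; part-disjoint = disjoint
      ; part-cover = cover
      ; #ZeroSums≡2^r = ≡.trans (#ZeroSums-block A⊆U minA x∈A)
          (≡.trans (≡.cong₂ _+_ #ZeroSums≡2^r #ZeroSums≡2^r) (≡.cong (2 ^ r +_) (≡.sym (+-identityʳ (2 ^ r)))))
      }
      where
      open Decomposition D
      A∩part=∅ : ∀ i → Disjoint A (lookup part i)
      A∩part=∅ i t∈A t∈part = x∈p─q⇒x∉q (part-⊆ i t∈part) t∈A
      disjoint : ∀ {i j} → i ≢ j → Disjoint (lookup (A ∷ part) i) (lookup (A ∷ part) j)
      disjoint {zero} {zero} 0≢0 = ⊥-elim (0≢0 ≡.refl)
      disjoint {zero} {suc j} _ = A∩part=∅ j
      disjoint {suc i} {zero} _ t∈part t∈A = A∩part=∅ i t∈A t∈part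
      disjoint {suc i} {suc j} i≢j = part-disjoint (i≢j ∘ ≡.cong suc)
      cover : ∀ {t} → t ∈ U → ∃ λ i → t ∈ lookup (A ∷ part) i
      cover {t} t∈U with t ∈? A
      ... | yes t∈A = zero , t∈A
      ... | no t∉A = let i , t∈part = part-cover (x∈p∧x∉q⇒x∈p─q t∈U t∉A) in suc i , t∈part

    decompose : ∀ {U} → Saturated U → ∃ (Decomposition S U)
    decompose {U} = go (⊂-wellFounded U)
      where
      go : ∀ {U} → Acc _⊂_ U → Saturated U → ∃ (Decomposition S U)
      go {U} (acc smaller) saturated with nonempty? U
      ... | no U-empty = 0 , decomposition-∅ U-empty
      ... | yes (x , x∈U) with saturated x∈U
      ...   | A , A⊆U , minA , x∈A =
        let r , D = go (smaller (p∩q≢∅⇒p─q⊂p U A (x , x∈p∩q⁺ (x∈U , x∈A)))) (saturated-─ saturated minA)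
        in suc r , decomposition-∷ A⊆U minA x∈A D

    disjointMinimals-equalTerms⇒ε : ∀ {A B p q} → MinimalZeroSum S A → MinimalZeroSum S B → Disjoint A B →
      p ∈ A → q ∈ B → lookup S p ≈ lookup S q → lookup S q ≈ ε
    disjointMinimals-equalTerms⇒ε {A} {B} {p} {q} (_ , σA≈ε , _) minB@(_ , σB≈ε , _) A∩B=∅ p∈A q∈B Sp≈Sq =
      trans (sym (σ-⁅⁆ S q)) (trans (reflexive (≡.cong (σ S) (≡.sym B≡⁅q⁆))) σB≈ε)
      where
      q∉A-p : q ∉ A - p
      q∉A-p q∈A-p = A∩B=∅ (proj₁ (x∈p-y⁻ q∈A-p)) q∈B
      C : Subset m
      C = A - p Δ ⁅ q ⁆
      A-p∩q=∅ : Disjoint (A - p) ⁅ q ⁆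
      A-p∩q=∅ t∈A-p t∈⁅q⁆ rewrite x∈⁅y⁆⇒x≡y q t∈⁅q⁆ = q∉A-p t∈A-p
      σC≈ε : σ S C ≈ ε
      σC≈ε = begin
        σ S C                         ≈⟨ σ-Δ-disjoint S A-p∩q=∅ ⟩
        σ S (A - p) ∙ σ S ⁅ q ⁆       ≈⟨ ∙-congˡ (trans (σ-⁅⁆ S q) (sym Sp≈Sq)) ⟩
        σ S (A - p) ∙ lookup S p      ≈⟨ comm _ _ ⟩
        lookup S p ∙ σ S (A - p)      ≈⟨ σ-remove S p∈A ⟨
        σ S A                         ≈⟨ σA≈ε ⟩
        ε                             ∎
        where open ≈-Reasoning
      B⊆⁅q⁆ : B ⊆ ⁅ q ⁆
      B⊆⁅q⁆ {t} t∈B with x∈pΔq⁻ (A - p) ⁅ q ⁆ (minimal⊆zeroSum σC≈ε minB (x∈pΔq⁺ (inj₂ (x∈⁅x⁆ q , q∉A-p))) q∈B t∈B)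
      ... | inj₁ (t∈A-p , _) = ⊥-elim (A∩B=∅ (proj₁ (x∈p-y⁻ t∈A-p)) t∈B)
      ... | inj₂ (t∈⁅q⁆ , _) = t∈⁅q⁆
      B≡⁅q⁆ : B ≡ ⁅ q ⁆
      B≡⁅q⁆ = ⊆-antisym B⊆⁅q⁆ (⁅x⁆⊆p q∈B)

    module Blocks {r} (D : Decomposition S full r) where
      open Decomposition D

      minimal⇒part : ∀ I → MinimalZeroSum S I → ∃ λ i → I ≡ lookup part i
      minimal⇒part I minI@((t , t∈I) , _) with part-cover ∈⊤
      ... | i , t∈part = i , unique (⊆-max I) (⊆-max _) minI (part-minimal i) t∈I t∈part

      parts-distinct : ∀ i j → i ≢ j → lookup part i ≢ lookup part j
      parts-distinct i j i≢j part-i≡part-j with part-minimal i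
      ... | (t , t∈part-i) , _ = part-disjoint i≢j t∈part-i (≡.subst (t ∈_) part-i≡part-j t∈part-i)

      parts-distinctTerms : (∀ p → ¬ lookup S p ≈ ε) → ∀ i j → i ≢ j → ∀ p q →
        p ∈ lookup part i → q ∈ lookup part j → ¬ lookup S p ≈ lookup S q
      parts-distinctTerms nonzero i j i≢j p q p∈part-i q∈part-j Sp≈Sq = nonzero q
        (disjointMinimals-equalTerms⇒ε (part-minimal i) (part-minimal j) (part-disjoint i≢j)
          p∈part-i q∈part-j Sp≈Sq)

  N≡#SumsTo-full : ∀ g (S : Vec Carrier m) → Defs.N G fin g S ≡ #SumsTo S full g
  N≡#SumsTo-full g S = ≡.trans (length-filter-allSubsets (λ I → σ S I ≈? g))
    (count-cong _ (sumsTo? S full g) (λ I σI≈g → ⊆-max I , σI≈g) (λ _ → proj₂))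

  #SumsTo-total≡#ZeroSums : ∀ (S : Vec Carrier m) → #SumsTo S full (σ S full) ≡ #SumsTo S full ε
  #SumsTo-total≡#ZeroSums S = ≡.trans (count-Δ (sumsTo? S full (σ S full)) full)
    (count-cong _ (sumsTo? S full ε)
      (λ I (_ , σIΔfull≈σfull) → ⊆-max I ,
        identityˡ-unique (σ S I) (σ S full) (trans (∙-congˡ (sym σIΔfull≈σfull)) (σ-Δ-full S I)))
      (λ I (_ , σI≈ε) → ⊆-max _ ,
        trans (sym (identityˡ _)) (trans (∙-congʳ (sym σI≈ε)) (σ-Δ-full S I))))

corollary3p6 : ∀ {c ℓ} (G : AbelianGroup c ℓ) (n : ℕ) (fin : FiniteOfOrder G n) →
    ¬ (2 ∣ n) →
    (d : ℕ) → IsDavenportConstant G d →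
    (m : ℕ) (S : Vec (AbelianGroup.Carrier G) m) →
    d ≤ suc m →
    (∀ p → ¬ (AbelianGroup._≈_ G (lookup S p) (AbelianGroup.ε G))) →
    (∀ g → (InE G fin d S g → AbelianGroup._≈_ G g (AbelianGroup.ε G))
         × (AbelianGroup._≈_ G g (AbelianGroup.ε G) → InE G fin d S g)) →
    Σ (Vec (Subset m) (m + 1 ∸ d)) λ T →
      (∀ i → IsMinimalZeroSum G S (lookup T i))
      × (∀ I → IsMinimalZeroSum G S I → ∃ λ i → I ≡ lookup T i)
      × (∀ i j → i ≢ j → lookup T i ≢ lookup T j)
      × (∀ i j → i ≢ j → ∀ p q → p ∈ lookup T i → q ∈ lookup T j →
           ¬ (AbelianGroup._≈_ G (lookup S p) (lookup S q)))
      × (∀ p → ∃ λ i → p ∈ lookup T i)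
corollary3p6 G n fin odd d (_ , davenport , _) m S _ nonzero E =
  part , part-minimal , minimal⇒part , parts-distinct , parts-distinctTerms nonzero , λ p → part-cover ∈⊤
  where
  open AbelianGroup G using (_≈_; ε; refl)
  open SubsetSums G using (σ)
  open ZeroSums G fin
  open Arithmetic using (2^-injective)
  #zeroSums : #SumsTo S full ε ≡ 2 ^ (m + 1 ∸ d)
  #zeroSums = ≡.trans (≡.sym (N≡#SumsTo-full ε S)) (proj₂ (E ε) refl)
  σS≈ε : σ S full ≈ ε
  σS≈ε = proj₁ (E (σ S full))
    (≡.trans (N≡#SumsTo-full _ S) (≡.trans (#SumsTo-total≡#ZeroSums S) #zeroSums))
  unique : UniqueMinimalThrough S full
  unique = unique-minimal-through davenport odd S
    (≡.trans #zeroSums (≡.cong (λ k → 2 ^ (k ∸ d)) (≡.trans (+-comm m 1) (≡.cong suc (≡.sym (∣⊤∣≡n m))))))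
  decomposition : ∃ (Decomposition S full)
  decomposition = decompose S unique λ x∈S →
    let A , _ , minA , x∈A = minimal-within S σS≈ε x∈S in A , ⊆-max A , minA , x∈A
  D : Decomposition S full (m + 1 ∸ d)
  D = ≡.subst (Decomposition S full)
    (2^-injective (≡.trans (≡.sym (Decomposition.#ZeroSums≡2^r (proj₂ decomposition))) #zeroSums))
    (proj₂ decomposition)
  open Decomposition D
  open Blocks S unique D
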